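{- Let $A$ have at least three elements and $I$ an arbitrary (possibly infinite) set. Suppose $C\colon\mathrm{PPO}_A^I\to\mathrm{PPO}_A$ is a principal voting system satisfying unanimity and independence of irrelevant alternatives that maps $\mathrm{LPO}_A^I$ into $\mathrm{LPO}_A$. Then $C=\mathrm{Lex}_{(J,\le)}$ for some subset $J\subseteq I$ equipped with a well-ordering $\le$, and the pair $(J,\le)$ is uniquely determined by $C$. Conversely, every such pair $(J,\le)$ is realized in this way, giving a bijection between these voting systems and well-ordered sets $(J,\le)$ with $J\subseteq I$. Moreover, $C$ satisfies strong unanimity if and only if $J=I$; hence principal voting systems satisfying unanimity and IIA that map $\mathrm{LPO}_A^I$ to $\mathrm{LPO}_A$ and satisfy strong unanimity are in bijective correspondence with well-orderings of $I$.
   Context: $\mathrm{PPO}_A$ is the set of reflexive transitive relations on $A$, $\mathrm{LPO}_A$ the complete ones. For a profile $P=(P_i)_{i\in I}$: $a\succsim b$ means $(a,b)\in C(P)$, $a\succsim_i b$ means $(a,b)\in P_i$; $\succ,\succ_i$ strict parts; $a\sim_i b$ means both directions; for $L\subseteq I$ subscripts $L$ mean "for all members of $L$". Unanimity: $a\succsim_I b\Rightarrow a\succsim b$. Strong unanimity: unanimity, and if $a\succsim_I b$ and $a\succ_i b$ for some $i$ then $a\succ b$. IIA: for profiles $P,P'$ with outcomes $\succsim,\succsim'$, if $\{i:a\succsim_i b\}=\{i:a\succsim'_i b\}$ and $\{i:b\succsim_i a\}=\{i:b\succsim'_i a\}$ then $a\succsim b\iff a\succsim'b$. For $N\subseteq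 I$, $L\subseteq I\setminus N$ is decisive relative to $N$ if for every profile and all $a,b$, $a\sim_N b$ and $a\succ_L b$ imply $a\succsim b$. $C$ is principal if for each $N\subseteq I$ there is a minimal subset of $I\setminus N$ decisive relative to $N$. For $J\subseteq I$ with a well-ordering $\le$, $\mathrm{Lex}_{(J,\le)}$ is defined by: $a\sim b$ iff $a\sim_J b$; otherwise let $j\in J$ be the $\le$-smallest element with not $a\sim_j b$, and set $a\succsim b$ iff $a\succsim_j b$, and $b\succsim a$ iff $b\succsim_j a$. -}

module Defs where

open import Level using (0ℓ) renaming (suc to lsuc)
open import Data.Product using (Σ; _×_; _,_; proj₁)
open import Data.Sum using (_⊎_)
open import Relation.Nullary using (¬_)
open import Relation.Binary.PropositionalEquality using (_≡_; _≢_)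
open import Function.Bundles using (_⇔_)

record PPO (A : Set) : Set₁ where
  field
    rel   : A → A → Set
    refl  : ∀ a → rel a a
    trans : ∀ {a b c} → rel a b → rel b c → rel a c

open PPO public

IsLPO : {A : Set} → PPO A → Set
IsLPO {A} R = ∀ (a b : A) → rel R a b ⊎ rel R b a

VotingSystem : Set → Set → Set₁
VotingSystem A I = (I → PPO A) → PPO A

Indiff : {A : Set} → PPO A → A → A → Set
Indiff R a b = rel R a b × rel R b a

Strict : {A : Set} → PPO A → A → A → Set
Strict R a b = rel R a b × ¬ rel R b a

AtLeastThree : Set → Set
AtLeastThree A = Σ A λ a → Σ A λ b → Σ A λ c → (a ≢ b) × (b ≢ c) × (a ≢ c)

module _ {A I : Set} where

  MapsLPO : VotingSystem A I → Set₁
  MapsLPO C = ∀ (P : I → PPO A) → (∀ i → IsLPO (P i)) → IsLPO (C P)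

  Unanimous : VotingSystem A I → Set₁
  Unanimous C = ∀ (P : I → PPO A) (a b : A) → (∀ i → rel (P i) a b) → rel (C P) a b

  StronglyUnanimous : VotingSystem A I → Set₁
  StronglyUnanimous C =
    Unanimous C ×
    (∀ (P : I → PPO A) (a b : A) → (∀ i → rel (P i) a b) →
       Σ I (λ i → Strict (P i) a b) → Strict (C P) a b)

  IIA : VotingSystem A I → Set₁
  IIA C = ∀ (P P′ : I → PPO A) (a b : A) →
    (∀ i → rel (P i) a b ⇔ rel (P′ i) a b) →
    (∀ i → rel (P i) b a ⇔ rel (P′ i) b a) →
    rel (C P) a b ⇔ rel (C P′) a b

  _⊆_ : (I → Set) → (I → Set) → Set
  L ⊆ L′ = ∀ i → L i → L′ i

  Decisive : VotingSystem A I → (N L : I → Set) → Set₁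
  Decisive C N L =
    (∀ i → L i → ¬ N i) ×
    (∀ (P : I → PPO A) (a b : A) →
       (∀ i → N i → Indiff (P i) a b) →
       (∀ i → L i → Strict (P i) a b) →
       rel (C P) a b)

  MinimalDecisive : VotingSystem A I → (N L : I → Set) → Set₁
  MinimalDecisive C N L =
    Decisive C N L × (∀ (L′ : I → Set) → L′ ⊆ L → Decisive C N L′ → L ⊆ L′)

  Principal : VotingSystem A I → Set₁
  Principal C = ∀ (N : I → Set) → Σ (I → Set) (MinimalDecisive C N)

  Admissible : VotingSystem A I → Set₁
  Admissible C = Principal C × Unanimous C × IIA C × MapsLPO C

-- ≤ is a well-ordering of the subset J ⊆ I (values of ≤ outside J are irrelevant)
record IsWellOrderOn {I : Set} (J : I → Set) (_≤_ : I → I → Set) : Set₁ where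
  field
    reflexive : ∀ i → J i → i ≤ i
    antisym   : ∀ i j → J i → J j → i ≤ j → j ≤ i → i ≡ j
    transitive : ∀ i j k → J i → J j → J k → i ≤ j → j ≤ k → i ≤ k
    total     : ∀ i j → J i → J j → (i ≤ j) ⊎ (j ≤ i)
    least     : ∀ (S : I → Set) → (∀ i → S i → J i) → Σ I S →
                Σ I (λ m → S m × (∀ i → S i → m ≤ i))

WOPair : Set → Set₁
WOPair I = Σ (I → Set) λ J → Σ (I → I → Set) λ _≤_ → IsWellOrderOn J _≤_

WOSet : {I : Set} → WOPair I → I → Set
WOSet W = proj₁ W

WOOrd : {I : Set} → WOPair I → I → I → Set
WOOrd (_ , ≤ , _) = ≤

-- the relation of Lex_(J,≤) applied to a profile P (unfolded):
-- a ≿ b iff a ∼_J b, or the ≤-least j ∈ J with ¬ (a ∼_j b) has a ≿_j b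
LexRel : {A I : Set} → (J : I → Set) → (I → I → Set) → (I → PPO A) → A → A → Set
LexRel {A} {I} J _≤_ P a b =
  (∀ j → J j → Indiff (P j) a b) ⊎
  Σ I (λ j → J j × ¬ Indiff (P j) a b ×
             (∀ k → J k → k ≤ j → k ≢ j → Indiff (P k) a b) ×
             rel (P j) a b)

Represents : {A I : Set} → VotingSystem A I → WOPair I → Set₁
Represents {A} {I} C W =
  ∀ (P : I → PPO A) (a b : A) → rel (C P) a b ⇔ LexRel (WOSet W) (WOOrd W) P a b

SameWO : {I : Set} → WOPair I → WOPair I → Set
SameWO {I} W W′ =
  (∀ i → WOSet W i ⇔ WOSet W′ i) ×
  (∀ i j → WOSet W i → WOSet W j → WOOrd W i j ⇔ WOOrd W′ i j)

-- By IIA, C compares two alternatives only through their pattern: which voters weakly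
-- prefer the first, and which the second. With a third alternative, unanimity lets one
-- alternative be cloned into another, so a single rule Φ on patterns governs every pair,
-- and Arrow's contagion argument applies: winning one contest makes a coalition decisive.
-- Principality gives, for every set N of indifferent voters, a minimal decisive set;
-- completeness (LPO to LPO) makes each of its members m decisive alone, and m also has a
-- veto: when N is indifferent, C never ranks a ≿ b unless m does. So m dictates among the
-- voters outside N. Let J consist of the voters whose lone strict preference overrides
-- everybody else's indifference, and let i precede j when i beats j in a duel. Then the
-- dictator relative to the complement of S is the least element of S, and the dictator
-- relative to the voters tied in a pattern is its first untied voter in J, which is
-- exactly Lex over (J, ≼). Conversely Lex is admissible, and it determines (J, ≤)
-- through its verdicts on solo and duel patterns.

module Submission where

open import Defs hiding (refl; trans)
open import Level using (0ℓ; lift; lower) renaming (suc to lsuc)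
open import Axiom.ExcludedMiddle using (ExcludedMiddle)
open import Data.Bool using (Bool; true; false)
open import Data.Empty using (⊥; ⊥-elim)
import Data.Empty.Irrelevant as Irrelevant
open import Data.Product using (Σ; _×_; _,_; proj₁; proj₂)
open import Data.Sum using (_⊎_; inj₁; inj₂; [_,_]′)
import Data.Sum as Sum
open import Data.Unit using (⊤; tt)
open import Function.Bundles using (_⇔_; mk⇔; Equivalence)
open import Function.Construct.Composition using (_⇔-∘_)
open import Function.Construct.Identity using (⇔-id)
open import Function.Construct.Symmetry using (⇔-sym)
open import Function.Base using (_∘_)
open import Relation.Nullary using (¬_; Dec; yes; no)
open import Relation.Nullary.Negation using (contradiction)
open import Relation.Nullary.Decidable using (map′; decidable-stable)
open import Relation.Binary.PropositionalEquality using (_≡_; _≢_; refl; sym; subst)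

open Equivalence using (to; from)

module Classical (em : ExcludedMiddle (lsuc 0ℓ)) where

  dec : (X : Set) → Dec X
  dec X = map′ lower lift em

  dne : {X : Set} → ¬ ¬ X → X
  dne {X} = decidable-stable (dec X)

-- Preorders on two or three points, and two-level preorders

record ThreePointSpec : Set₁ where
  field
    ab ba ac ca bc cb : Set
    abc : ab → bc → ac
    acb : ac → cb → ab
    bac : ba → ac → bc
    bca : bc → ca → ba
    cab : ca → ab → cb
    cba : cb → ba → ca

data Three : Set where
  pa pb pc : Three

module _ {A : Set} where

  module Transported {Pt : Set} (el : Pt → A) (el-injective : ∀ {u v} → el u ≡ el v → u ≡ v)
                     (M : Pt → Pt → Set) (M-refl : ∀ u → M u u)
                     (M-trans : ∀ u v w → M u v → M v w → M u w) where

    R : A → A → Set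
    R d e = d ≡ e ⊎ Σ Pt λ u → Σ Pt λ v → d ≡ el u × e ≡ el v × M u v

    R-trans : ∀ {d e f} → R d e → R e f → R d f
    R-trans (inj₁ refl) r = r
    R-trans (inj₂ q) (inj₁ refl) = inj₂ q
    R-trans (inj₂ (u , v , refl , refl , m)) (inj₂ (v′ , w , e , refl , m′)) with el-injective e
    ... | refl = inj₂ (u , w , refl , refl , M-trans u v w m m′)

    preorder : PPO A
    preorder = record { rel = R ; refl = λ _ → inj₁ refl ; trans = R-trans }

    preorder-el : ∀ u v → rel preorder (el u) (el v) ⇔ M u v
    preorder-el u v = mk⇔ back (λ m → inj₂ (u , v , refl , refl , m))
      where
      back : R (el u) (el v) → M u v
      back (inj₁ e) with el-injective e
      ... | refl = M-refl u
      back (inj₂ (u′ , v′ , e , e′ , m)) with el-injective e | el-injective e′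
      ... | refl | refl = m

  -- Distinctness is irrelevant, so the preorder does not depend on which proof of it is used.
  module _ (u v : A) .(u≢v : u ≢ v) (p q : Set) where

    private
      point : Bool → A
      point true = u
      point false = v

      point-injective : ∀ {s t} → point s ≡ point t → s ≡ t
      point-injective {true} {true} _ = refl
      point-injective {true} {false} e = Irrelevant.⊥-elim (u≢v e)
      point-injective {false} {true} e = Irrelevant.⊥-elim (u≢v (sym e))
      point-injective {false} {false} _ = refl

      M : Bool → Bool → Set
      M true false = p
      M false true = q
      M _ _ = ⊤

      M-refl : ∀ s → M s s
      M-refl true = tt
      M-refl false = tt

      M-trans : ∀ s t r → M s t → M t r → M s r
      M-trans true true r _ m = m
      M-trans false false r _ m = m
      M-trans true false true _ _ = tt
      M-trans true false false m _ = m
      M-trans false true false _ _ = tt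
      M-trans false true true m _ = m

      open Transported point point-injective M M-refl M-trans

    twoPoint : PPO A
    twoPoint = preorder

    twoPoint-uv : rel twoPoint u v ⇔ p
    twoPoint-uv = preorder-el true false

    twoPoint-vu : rel twoPoint v u ⇔ q
    twoPoint-vu = preorder-el false true

  module _ {a b c : A} .(a≢b : a ≢ b) .(b≢c : b ≢ c) .(a≢c : a ≢ c) (T : ThreePointSpec) where

    open ThreePointSpec T

    private
      point : Three → A
      point pa = a
      point pb = b
      point pc = c

      point-injective : ∀ {s t} → point s ≡ point t → s ≡ t
      point-injective {pa} {pa} _ = refl
      point-injective {pa} {pb} e = Irrelevant.⊥-elim (a≢b e)
      point-injective {pa} {pc} e = Irrelevant.⊥-elim (a≢c e)
      point-injective {pb} {pa} e = Irrelevant.⊥-elim (a≢b (sym e))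
      point-injective {pb} {pb} _ = refl
      point-injective {pb} {pc} e = Irrelevant.⊥-elim (b≢c e)
      point-injective {pc} {pa} e = Irrelevant.⊥-elim (a≢c (sym e))
      point-injective {pc} {pb} e = Irrelevant.⊥-elim (b≢c (sym e))
      point-injective {pc} {pc} _ = refl

      M : Three → Three → Set
      M pa pb = ab
      M pb pa = ba
      M pa pc = ac
      M pc pa = ca
      M pb pc = bc
      M pc pb = cb
      M _ _ = ⊤

      M-refl : ∀ s → M s s
      M-refl pa = tt
      M-refl pb = tt
      M-refl pc = tt

      M-trans : ∀ s t r → M s t → M t r → M s r
      M-trans pa pa r _ m = m
      M-trans pb pb r _ m = m
      M-trans pc pc r _ m = m
      M-trans s pa pa m _ = m
      M-trans s pb pb m _ = m
      M-trans s pc pc m _ = m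
      M-trans pa pb pa _ _ = tt
      M-trans pa pc pa _ _ = tt
      M-trans pb pa pb _ _ = tt
      M-trans pb pc pb _ _ = tt
      M-trans pc pa pc _ _ = tt
      M-trans pc pb pc _ _ = tt
      M-trans pa pb pc m n = abc m n
      M-trans pa pc pb m n = acb m n
      M-trans pb pa pc m n = bac m n
      M-trans pb pc pa m n = bca m n
      M-trans pc pa pb m n = cab m n
      M-trans pc pb pa m n = cba m n

      open Transported point point-injective M M-refl M-trans

    threePoint : PPO A
    threePoint = preorder

    threePoint-ab : rel threePoint a b ⇔ ab
    threePoint-ab = preorder-el pa pb

    threePoint-ba : rel threePoint b a ⇔ ba
    threePoint-ba = preorder-el pb pa

    threePoint-ac : rel threePoint a c ⇔ ac
    threePoint-ac = preorder-el pa pc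

    threePoint-ca : rel threePoint c a ⇔ ca
    threePoint-ca = preorder-el pc pa

    threePoint-bc : rel threePoint b c ⇔ bc
    threePoint-bc = preorder-el pb pc

    threePoint-cb : rel threePoint c b ⇔ cb
    threePoint-cb = preorder-el pc pb

indicatorPreorder : {A : Set} → (A → Set) → PPO A
indicatorPreorder R = record { rel = λ d e → R e → R d ; refl = λ _ r → r ; trans = λ p q r → p (q r) }

indicatorPreorder-complete : {A : Set} {R : A → Set} → (∀ d → Dec (R d)) → IsLPO (indicatorPreorder R)
indicatorPreorder-complete R? d e with R? d
... | yes Rd = inj₁ (λ _ → Rd)
... | no ¬Rd = inj₂ (λ Rd → ⊥-elim (¬Rd Rd))

-- Patterns

Pattern : Set → Set₁
Pattern I = I → Set × Set

-- By IIA, this is all a voting system may use to compare a with b.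
patternOf : {A I : Set} → (I → PPO A) → A → A → Pattern I
patternOf P a b i = rel (P i) a b , rel (P i) b a

module _ {I : Set} where

  pro con Tie : Pattern I → I → Set
  pro π i = proj₁ (π i)
  con π i = proj₂ (π i)
  Tie π i = pro π i × con π i

  swap : Pattern I → Pattern I
  swap π i = con π i , pro π i

  _≈_ : Pattern I → Pattern I → Set
  π ≈ π′ = ∀ i → (pro π i ⇔ pro π′ i) × (con π i ⇔ con π′ i)

  ≈-sym : ∀ {π π′} → π ≈ π′ → π′ ≈ π
  ≈-sym e i = ⇔-sym (proj₁ (e i)) , ⇔-sym (proj₂ (e i))

  ≈-trans : ∀ {π π′ π″} → π ≈ π′ → π′ ≈ π″ → π ≈ π″
  ≈-trans e e′ i = proj₁ (e′ i) ⇔-∘ proj₁ (e i) , proj₂ (e′ i) ⇔-∘ proj₂ (e i)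

  ≈-swap : ∀ {π π′} → π ≈ π′ → swap π ≈ swap π′
  ≈-swap e i = proj₂ (e i) , proj₁ (e i)

  Tie-resp : ∀ {π π′} → π ≈ π′ → ∀ i → Tie π i → Tie π′ i
  Tie-resp e i (p , c) = to (proj₁ (e i)) p , to (proj₂ (e i)) c

  solo : I → Pattern I
  solo j k = (k ≢ j) , ⊤

  duel : I → I → Pattern I
  duel i j k = (k ≢ j) , (k ≢ i)

module _ {A I : Set} {u v : A} .(u≢v : u ≢ v) where

  pairProfile : Pattern I → I → PPO A
  pairProfile π i = twoPoint u v u≢v (pro π i) (con π i)

  pairProfile-pattern : (π : Pattern I) → patternOf (pairProfile π) u v ≈ π
  pairProfile-pattern π i =
    twoPoint-uv u v u≢v (pro π i) (con π i) , twoPoint-vu u v u≢v (pro π i) (con π i)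

-- Lexicographic voting systems

module _ {I : Set} (J : I → Set) (_≤_ : I → I → Set) where

  DecidedAt : Pattern I → I → Set
  DecidedAt π j = J j × ¬ Tie π j × (∀ k → J k → k ≤ j → k ≢ j → Tie π k) × pro π j

  -- LexRel J _≤_ P a b unfolds to LexPat (patternOf P a b)
  LexPat : Pattern I → Set
  LexPat π = (∀ j → J j → Tie π j) ⊎ Σ I (DecidedAt π)

  LexPat-resp : ∀ {π π′} → π ≈ π′ → LexPat π → LexPat π′
  LexPat-resp e (inj₁ all) = inj₁ (λ j Jj → Tie-resp e j (all j Jj))
  LexPat-resp e (inj₂ (j , Jj , ¬tie , before , p)) =
    inj₂ (j , Jj , (λ t → ¬tie (Tie-resp (≈-sym e) j t)) ,
          (λ k Jk k≤j k≢j → Tie-resp e k (before k Jk k≤j k≢j)) , to (proj₁ (e j)) p)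

  LexPat-cong : ∀ {π π′} → π ≈ π′ → LexPat π ⇔ LexPat π′
  LexPat-cong e = mk⇔ (LexPat-resp e) (LexPat-resp (≈-sym e))

  lex-con-unanimous : ∀ {π} → (∀ k → con π k) → LexPat π → ∀ j → J j → pro π j
  lex-con-unanimous _ (inj₁ all) j Jj = proj₁ (all j Jj)
  lex-con-unanimous c (inj₂ (k , _ , ¬tie , _ , p)) _ _ = ⊥-elim (¬tie (p , c k))

  lex-solo : ∀ j → LexPat (solo j) ⇔ (¬ J j)
  lex-solo j = mk⇔ (λ l Jj → lex-con-unanimous (λ _ → tt) l j Jj refl)
                   (λ ¬Jj → inj₁ (λ k Jk → (λ { refl → ¬Jj Jk }) , tt))

module Lex (em : ExcludedMiddle (lsuc 0ℓ)) {I : Set} {J : I → Set} {_≤_ : I → I → Set}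
           (wo : IsWellOrderOn J _≤_) where

  open Classical em
  open IsWellOrderOn wo

  ≤-<⇒≢ : ∀ {i j k} → J j → J k → i ≤ j → j ≤ k → j ≢ k → i ≢ k
  ≤-<⇒≢ {j = j} {k} Jj Jk i≤j j≤k j≢k refl = j≢k (antisym j k Jj Jk j≤k i≤j)

  first-untied : (π : Pattern I) →
    (∀ j → J j → Tie π j) ⊎
    Σ I (λ m → J m × ¬ Tie π m × (∀ k → J k → k ≤ m → k ≢ m → Tie π k))
  first-untied π with dec (Σ I λ j → J j × ¬ Tie π j)
  ... | no none = inj₁ (λ j Jj → dne (λ ¬tie → none (j , Jj , ¬tie)))
  ... | yes some with least (λ j → J j × ¬ Tie π j) (λ _ → proj₁) some
  ... | m , (Jm , ¬tie) , minimal =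
    inj₂ (m , Jm , ¬tie , λ k Jk k≤m k≢m →
      dne (λ ¬tieₖ → k≢m (antisym k m Jk Jm k≤m (minimal k (Jk , ¬tieₖ)))))

  lex-unanimous : ∀ {π} → (∀ i → pro π i) → LexPat J _≤_ π
  lex-unanimous {π} all-pro with first-untied π
  ... | inj₁ tied = inj₁ tied
  ... | inj₂ (m , Jm , ¬tie , before) = inj₂ (m , Jm , ¬tie , before , all-pro m)

  lex-complete : ∀ {π} → (∀ i → pro π i ⊎ con π i) → LexPat J _≤_ π ⊎ LexPat J _≤_ (swap π)
  lex-complete {π} complete with first-untied π
  ... | inj₁ tied = inj₁ (inj₁ tied)
  ... | inj₂ (m , Jm , ¬tie , before) with complete m
  ...   | inj₁ p = inj₁ (inj₂ (m , Jm , ¬tie , before , p))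
  ...   | inj₂ c = inj₂ (inj₂ (m , Jm , (λ (c , p) → ¬tie (p , c)) ,
                                (λ k Jk k≤m k≢m → let (p , c) = before k Jk k≤m k≢m in c , p) , c))

  module _ {A : Set} (P : I → PPO A) where

    private
      tie-trans : ∀ {j a b c} → Indiff (P j) a b → Indiff (P j) b c → Indiff (P j) a c
      tie-trans {j} (p , q) (p′ , q′) = PPO.trans (P j) p p′ , PPO.trans (P j) q′ q

      tie-sym : ∀ {j a b} → Indiff (P j) a b → Indiff (P j) b a
      tie-sym (p , q) = q , p

    decided-then-tied : ∀ {a b c j} → DecidedAt J _≤_ (patternOf P a b) j →
      (∀ k → J k → k ≤ j → Indiff (P k) b c) → DecidedAt J _≤_ (patternOf P a c) j
    decided-then-tied {b = b} {c} {j} (Jj , ¬tie , before , p) tied =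
      Jj , (λ t → ¬tie (tie-trans t (tie-sym tiedⱼ))) ,
      (λ k Jk k≤j k≢j → tie-trans (before k Jk k≤j k≢j) (tied k Jk k≤j)) ,
      PPO.trans (P j) p (proj₁ tiedⱼ)
      where
      tiedⱼ : Indiff (P j) b c
      tiedⱼ = tied j Jj (reflexive j Jj)

    tied-then-decided : ∀ {a b c j} → (∀ k → J k → k ≤ j → Indiff (P k) a b) →
      DecidedAt J _≤_ (patternOf P b c) j → DecidedAt J _≤_ (patternOf P a c) j
    tied-then-decided {a} {b} {j = j} tied (Jj , ¬tie , before , p) =
      Jj , (λ t → ¬tie (tie-trans (tie-sym tiedⱼ) t)) ,
      (λ k Jk k≤j k≢j → tie-trans (tied k Jk k≤j) (before k Jk k≤j k≢j)) ,
      PPO.trans (P j) (proj₁ tiedⱼ) p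
      where
      tiedⱼ : Indiff (P j) a b
      tiedⱼ = tied j Jj (reflexive j Jj)

    decided-decided : ∀ {a b c j} → DecidedAt J _≤_ (patternOf P a b) j →
      DecidedAt J _≤_ (patternOf P b c) j → DecidedAt J _≤_ (patternOf P a c) j
    decided-decided {j = j} (Jj , ¬tie , before , p) (_ , _ , before′ , p′) =
      Jj , (λ t → ¬tie (p , PPO.trans (P j) p′ (proj₂ t))) ,
      (λ k Jk k≤j k≢j → tie-trans (before k Jk k≤j k≢j) (before′ k Jk k≤j k≢j)) ,
      PPO.trans (P j) p p′

    lex-trans : ∀ {a b c} → LexRel J _≤_ P a b → LexRel J _≤_ P b c → LexRel J _≤_ P a c
    lex-trans (inj₁ f) (inj₁ g) = inj₁ (λ j Jj → tie-trans (f j Jj) (g j Jj))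
    lex-trans (inj₁ f) (inj₂ (j , t)) = inj₂ (j , tied-then-decided (λ k Jk _ → f k Jk) t)
    lex-trans (inj₂ (j , s)) (inj₁ g) = inj₂ (j , decided-then-tied s (λ k Jk _ → g k Jk))
    lex-trans (inj₂ (j , s@(Jj , _ , before , _))) (inj₂ (k , t@(Jk , _ , before′ , _)))
      with dec (j ≡ k)
    ... | yes refl = inj₂ (j , decided-decided s t)
    ... | no j≢k with total j k Jj Jk
    ...   | inj₁ j≤k = inj₂ (j , decided-then-tied s (λ i Ji i≤j →
                          before′ i Ji (transitive i j k Ji Jj Jk i≤j j≤k)
                                       (≤-<⇒≢ Jj Jk i≤j j≤k j≢k)))
    ...   | inj₂ k≤j = inj₂ (k , tied-then-decided (λ i Ji i≤k →
                          before i Ji (transitive i k j Ji Jk Jj i≤k k≤j)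
                                      (≤-<⇒≢ Jk Jj i≤k k≤j (j≢k ∘ sym))) t)

  lex-duel : ∀ {i j} → J i → J j → i ≢ j → (i ≤ j) ⇔ LexPat J _≤_ (duel i j)
  lex-duel {i} {j} Ji Jj i≢j = mk⇔ decided decided⁻¹
    where
    decided : i ≤ j → LexPat J _≤_ (duel i j)
    decided i≤j = inj₂ (i , Ji , (λ t → proj₂ t refl) , before , i≢j)
      where
      before : ∀ k → J k → k ≤ i → k ≢ i → Tie (duel i j) k
      before k Jk k≤i k≢i = ≤-<⇒≢ Ji Jj k≤i i≤j i≢j , k≢i
    decided⁻¹ : LexPat J _≤_ (duel i j) → i ≤ j
    decided⁻¹ (inj₁ all) = ⊥-elim (proj₂ (all i Ji) refl)
    decided⁻¹ (inj₂ (k , Jk , ¬tie , before , k≢j)) with dne (λ k≢i → ¬tie (k≢j , k≢i))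
    ... | refl with total i j Ji Jj
    ...   | inj₁ i≤j = i≤j
    ...   | inj₂ j≤i = ⊥-elim (proj₁ (before j Jj j≤i (i≢j ∘ sym)) refl)

  lexSystem : {A : Set} → VotingSystem A I
  lexSystem P = record
    { rel = LexRel J _≤_ P
    ; refl = λ a → inj₁ (λ j _ → PPO.refl (P j) a , PPO.refl (P j) a)
    ; trans = lex-trans P
    }

  lex-principal : {A : Set} {x y : A} → x ≢ y → Principal (lexSystem {A})
  lex-principal {A} {x} {y} x≢y N with dec (Σ I λ j → J j × ¬ N j)
  ... | no none =
    (λ _ → ⊥) ,
    ((λ _ ()) , λ P a b tied _ → inj₁ (λ j Jj → tied j (dne (λ ¬Nj → none (j , Jj , ¬Nj))))) ,
    λ _ _ _ _ ()
  ... | yes some with least (λ j → J j × ¬ N j) (λ _ → proj₁) some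
  ... | m , (Jm , ¬Nm) , minimal = (_≡ m) , ((λ { _ refl → ¬Nm }) , decisive) , isMinimal
    where
    decisive : ∀ P a b → (∀ i → N i → Indiff (P i) a b) → (∀ i → i ≡ m → Strict (P i) a b) →
               rel (lexSystem P) a b
    decisive P a b tied strict = inj₂ (m , Jm , (λ t → proj₂ strictₘ (proj₂ t)) , before , proj₁ strictₘ)
      where
      strictₘ : Strict (P m) a b
      strictₘ = strict m refl

      before : ∀ k → J k → k ≤ m → k ≢ m → Indiff (P k) a b
      before k Jk k≤m k≢m with dec (N k)
      ... | yes Nk = tied k Nk
      ... | no ¬Nk = ⊥-elim (k≢m (antisym k m Jk Jm k≤m (minimal k (Jk , ¬Nk))))

    -- the profile where N is indifferent and everybody else strictly prefers y defeats any L ∌ m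
    isMinimal : ∀ L → _⊆_ {A} L (_≡ m) → Decisive lexSystem N L → _⊆_ {A} (_≡ m) L
    isMinimal L L⊆m (_ , L-decisive) _ refl = dne λ ¬Lm →
      ¬Nm (lex-con-unanimous J _≤_ (λ _ → tt)
             (LexPat-resp J _≤_ (pairProfile-pattern x≢y π)
               (L-decisive (pairProfile x≢y π) x y
                  (λ k Nk → Tie-resp (≈-sym (pairProfile-pattern x≢y π)) k (Nk , tt))
                  (λ k Lk → ⊥-elim (¬Lm (subst L (L⊆m k Lk) Lk)))))
             m Jm)
      where
      π : Pattern I
      π k = N k , ⊤

  lex-admissible : {A : Set} {x y : A} → x ≢ y → Admissible (lexSystem {A})
  lex-admissible x≢y =
    lex-principal x≢y ,
    (λ P a b all → lex-unanimous all) ,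
    (λ P P′ a b same-pro same-con → LexPat-cong J _≤_ (λ i → same-pro i , same-con i)) ,
    λ P complete a b → lex-complete (λ i → complete i a b)

  module _ {A : Set} {x y : A} (x≢y : x ≢ y) (C : VotingSystem A I)
           (rep : Represents C (J , _≤_ , wo)) where

    represents-pattern : ∀ π → rel (C (pairProfile x≢y π)) x y ⇔ LexPat J _≤_ π
    represents-pattern π = LexPat-cong J _≤_ (pairProfile-pattern x≢y π) ⇔-∘ rep (pairProfile x≢y π) x y

    stronglyUnanimous⇔J-total : StronglyUnanimous C ⇔ (∀ i → J i)
    stronglyUnanimous⇔J-total = mk⇔ J-total stronglyUnanimous
      where
      J-total : StronglyUnanimous C → ∀ i → J i
      J-total (_ , strict) i = dne λ ¬Ji →
        proj₂ (strict P x y (λ k → from (proj₁ (pattern-P k)) tt)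
                      (i , from (proj₁ (pattern-P i)) tt , λ r → to (proj₂ (pattern-P i)) r refl))
              (from (rep P y x)
                    (LexPat-resp J _≤_ (≈-sym (≈-swap pattern-P)) (from (lex-solo J _≤_ i) ¬Ji)))
        where
        P : I → PPO A
        P = pairProfile x≢y (swap (solo i))

        pattern-P : patternOf P x y ≈ swap (solo i)
        pattern-P = pairProfile-pattern x≢y (swap (solo i))

      stronglyUnanimous : (∀ i → J i) → StronglyUnanimous C
      stronglyUnanimous all-J = unanimous , λ P a b all (i , strictᵢ) → unanimous P a b all , λ r →
        not-reversed P a b all i strictᵢ (to (rep P b a) r)
        where
        unanimous : Unanimous C
        unanimous P a b all = from (rep P a b) (lex-unanimous all)

        not-reversed : ∀ P a b → (∀ i → rel (P i) a b) → ∀ i → Strict (P i) a b → ¬ LexRel J _≤_ P b a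
        not-reversed P a b all i strictᵢ (inj₁ tied) = proj₂ strictᵢ (proj₁ (tied i (all-J i)))
        not-reversed P a b all i strictᵢ (inj₂ (m , _ , ¬tie , _ , r)) = ¬tie (r , all m)

module _ (em : ExcludedMiddle (lsuc 0ℓ)) {I : Set} where

  open Classical em

  private
    lex-determines-set : (W W′ : WOPair I) →
      (∀ π → LexPat (WOSet W) (WOOrd W) π ⇔ LexPat (WOSet W′) (WOOrd W′) π) →
      ∀ i → WOSet W i → WOSet W′ i
    lex-determines-set W W′ same i Ji =
      dne λ ¬J′i → to (lex-solo (WOSet W) (WOOrd W) i)
                      (from (same (solo i)) (from (lex-solo (WOSet W′) (WOOrd W′) i) ¬J′i)) Ji

  lex-determines : (W W′ : WOPair I) →
    (∀ π → LexPat (WOSet W) (WOOrd W) π ⇔ LexPat (WOSet W′) (WOOrd W′) π) → SameWO W W′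
  lex-determines W@(J , _≤_ , wo) W′@(J′ , _≤′_ , wo′) same = J⇔J′ , ≤⇔≤′
    where
    J⇔J′ : ∀ i → J i ⇔ J′ i
    J⇔J′ i = mk⇔ (lex-determines-set W W′ same i) (lex-determines-set W′ W (⇔-sym ∘ same) i)

    ≤⇔≤′ : ∀ i j → J i → J j → (i ≤ j) ⇔ (i ≤′ j)
    ≤⇔≤′ i j Ji Jj with dec (i ≡ j)
    ... | yes refl = mk⇔ (λ _ → IsWellOrderOn.reflexive wo′ i (to (J⇔J′ i) Ji))
                         (λ _ → IsWellOrderOn.reflexive wo i Ji)
    ... | no i≢j = ⇔-sym (Lex.lex-duel em wo′ (to (J⇔J′ i) Ji) (to (J⇔J′ j) Jj) i≢j) ⇔-∘
                   (same (duel i j) ⇔-∘ Lex.lex-duel em wo Ji Jj i≢j)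

  represents-unique : {A : Set} {x y : A} → x ≢ y → (C : VotingSystem A I) (W W′ : WOPair I) →
    Represents C W → Represents C W′ → SameWO W W′
  represents-unique x≢y C W@(_ , _ , wo) W′@(_ , _ , wo′) rep rep′ = lex-determines W W′ λ π →
    Lex.represents-pattern em wo′ x≢y C rep′ π ⇔-∘ ⇔-sym (Lex.represents-pattern em wo x≢y C rep π)

-- Admissible voting systems are lexicographic

module Forward (em : ExcludedMiddle (lsuc 0ℓ)) {A I : Set} {x y z : A}
               (x≢y : x ≢ y) (y≢z : y ≢ z) (x≢z : x ≢ z) (C : VotingSystem A I)
               (principal : Principal C) (unanimous : Unanimous C) (iia : IIA C)
               (mapsLPO : MapsLPO C) where

  open Classical em

  iia-pattern : ∀ {P P′ u v} → patternOf P u v ≈ patternOf P′ u v → rel (C P) u v ⇔ rel (C P′) u v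
  iia-pattern {P} {P′} {u} {v} e = iia P P′ u v (proj₁ ∘ e) (proj₂ ∘ e)

  Accepts : (u v : A) → .(u ≢ v) → Pattern I → Set
  Accepts u v u≢v π = rel (C (pairProfile u≢v π)) u v

  C⇔Accepts : ∀ P {u v} .(u≢v : u ≢ v) → rel (C P) u v ⇔ Accepts u v u≢v (patternOf P u v)
  C⇔Accepts P u≢v = iia-pattern (≈-sym (pairProfile-pattern u≢v (patternOf P _ _)))

  Accepts-cong : ∀ {u v} .(u≢v : u ≢ v) {π π′} → π ≈ π′ → Accepts u v u≢v π ⇔ Accepts u v u≢v π′
  Accepts-cong u≢v {π} {π′} e =
    iia-pattern (≈-trans (pairProfile-pattern u≢v π) (≈-trans e (≈-sym (pairProfile-pattern u≢v π′))))

  -- Neutrality: an alternative c unanimously tied with a (resp. b) can take over its role.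
  replace-left : ∀ {a b c} .(a≢b : a ≢ b) .(b≢c : b ≢ c) .(a≢c : a ≢ c) {π} →
    Accepts a b a≢b π → Accepts c b (b≢c ∘ sym) π
  replace-left {a} {b} {c} a≢b b≢c a≢c {π} a≿b =
    to (Accepts-cong _ Q-cb) (to (C⇔Accepts Q (b≢c ∘ sym)) (PPO.trans (C Q) c≿a a≿b′))
    where
    T : I → ThreePointSpec
    T i = record { ab = pro π i ; ba = con π i ; ac = ⊤ ; ca = ⊤ ; bc = con π i ; cb = pro π i
                 ; abc = λ _ _ → tt ; acb = λ _ p → p ; bac = λ c _ → c ; bca = λ c _ → c
                 ; cab = λ _ p → p ; cba = λ _ _ → tt }
    Q : I → PPO A
    Q i = threePoint a≢b b≢c a≢c (T i)
    Q-ab : patternOf Q a b ≈ π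
    Q-ab i = threePoint-ab a≢b b≢c a≢c (T i) , threePoint-ba a≢b b≢c a≢c (T i)
    Q-cb : patternOf Q c b ≈ π
    Q-cb i = threePoint-cb a≢b b≢c a≢c (T i) , threePoint-bc a≢b b≢c a≢c (T i)
    c≿a : rel (C Q) c a
    c≿a = unanimous Q c a (λ i → from (threePoint-ca a≢b b≢c a≢c (T i)) tt)
    a≿b′ : rel (C Q) a b
    a≿b′ = from (C⇔Accepts Q a≢b) (from (Accepts-cong a≢b Q-ab) a≿b)

  replace-right : ∀ {a b c} .(a≢b : a ≢ b) .(b≢c : b ≢ c) .(a≢c : a ≢ c) {π} →
    Accepts a b a≢b π → Accepts a c a≢c π
  replace-right {a} {b} {c} a≢b b≢c a≢c {π} a≿b =
    to (Accepts-cong _ Q-ac) (to (C⇔Accepts Q a≢c) (PPO.trans (C Q) a≿b′ b≿c))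
    where
    T : I → ThreePointSpec
    T i = record { ab = pro π i ; ba = con π i ; ac = pro π i ; ca = con π i ; bc = ⊤ ; cb = ⊤
                 ; abc = λ p _ → p ; acb = λ p _ → p ; bac = λ _ _ → tt ; bca = λ _ c → c
                 ; cab = λ _ _ → tt ; cba = λ _ c → c }
    Q : I → PPO A
    Q i = threePoint a≢b b≢c a≢c (T i)
    Q-ab : patternOf Q a b ≈ π
    Q-ab i = threePoint-ab a≢b b≢c a≢c (T i) , threePoint-ba a≢b b≢c a≢c (T i)
    Q-ac : patternOf Q a c ≈ π
    Q-ac i = threePoint-ac a≢b b≢c a≢c (T i) , threePoint-ca a≢b b≢c a≢c (T i)
    b≿c : rel (C Q) b c
    b≿c = unanimous Q b c (λ i → from (threePoint-bc a≢b b≢c a≢c (T i)) tt)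
    a≿b′ : rel (C Q) a b
    a≿b′ = from (C⇔Accepts Q a≢b) (from (Accepts-cong a≢b Q-ab) a≿b)

  replace-left⇔ : ∀ {a b c} (a≢b : a ≢ b) (c≢b : c ≢ b) π → Accepts a b a≢b π ⇔ Accepts c b c≢b π
  replace-left⇔ {a} {b} {c} a≢b c≢b π with dec (a ≡ c)
  ... | yes refl = ⇔-id _
  ... | no a≢c = mk⇔ (replace-left a≢b (c≢b ∘ sym) a≢c) (replace-left c≢b (a≢b ∘ sym) (a≢c ∘ sym))

  replace-right⇔ : ∀ {a b c} (a≢b : a ≢ b) (a≢c : a ≢ c) π → Accepts a b a≢b π ⇔ Accepts a c a≢c π
  replace-right⇔ {a} {b} {c} a≢b a≢c π with dec (b ≡ c)
  ... | yes refl = ⇔-id _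
  ... | no b≢c = mk⇔ (replace-right a≢b b≢c a≢c) (replace-right a≢c (b≢c ∘ sym) a≢b)

  Φ : Pattern I → Set
  Φ = Accepts x y x≢y

  Φ-cong : ∀ {π π′} → π ≈ π′ → Φ π ⇔ Φ π′
  Φ-cong = Accepts-cong x≢y

  neutral : ∀ {u v} (u≢v : u ≢ v) π → Φ π ⇔ Accepts u v u≢v π
  neutral {u} {v} u≢v π with dec (v ≡ x)
  ... | no v≢x = replace-left⇔ (v≢x ∘ sym) u≢v π ⇔-∘ replace-right⇔ x≢y (v≢x ∘ sym) π
  ... | yes refl with dec (u ≡ y)
  ... | no u≢y = replace-right⇔ u≢y u≢v π ⇔-∘ replace-left⇔ x≢y u≢y π
  ... | yes refl = replace-left⇔ (x≢z ∘ sym) u≢v π ⇔-∘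
                   (replace-right⇔ (y≢z ∘ sym) (x≢z ∘ sym) π ⇔-∘ replace-left⇔ x≢y (y≢z ∘ sym) π)

  C⇔Φ : ∀ P {u v} → u ≢ v → rel (C P) u v ⇔ Φ (patternOf P u v)
  C⇔Φ P u≢v = ⇔-sym (neutral u≢v _) ⇔-∘ C⇔Accepts P u≢v

  module Triangle (T : I → ThreePointSpec) where

    open ThreePointSpec

    Q : I → PPO A
    Q i = threePoint x≢y y≢z x≢z (T i)

    patXY patXZ patZY : Pattern I
    patXY i = ab (T i) , ba (T i)
    patXZ i = ac (T i) , ca (T i)
    patZY i = cb (T i) , bc (T i)

    Φ⇒xz : Φ patXZ → rel (C Q) x z
    Φ⇒xz φ = from (C⇔Φ Q x≢z) (from (Φ-cong Q-xz) φ)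
      where
      Q-xz : patternOf Q x z ≈ patXZ
      Q-xz i = threePoint-ac x≢y y≢z x≢z (T i) , threePoint-ca x≢y y≢z x≢z (T i)

    Φ⇒zy : Φ patZY → rel (C Q) z y
    Φ⇒zy φ = from (C⇔Φ Q (y≢z ∘ sym)) (from (Φ-cong Q-zy) φ)
      where
      Q-zy : patternOf Q z y ≈ patZY
      Q-zy i = threePoint-cb x≢y y≢z x≢z (T i) , threePoint-bc x≢y y≢z x≢z (T i)

    xz-zy⇒Φ : rel (C Q) x z → rel (C Q) z y → Φ patXY
    xz-zy⇒Φ x≿z z≿y = to (Φ-cong Q-xy) (to (C⇔Φ Q x≢y) (PPO.trans (C Q) x≿z z≿y))
      where
      Q-xy : patternOf Q x y ≈ patXY
      Q-xy i = threePoint-ab x≢y y≢z x≢z (T i) , threePoint-ba x≢y y≢z x≢z (T i)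

    transitive : Φ patXZ → Φ patZY → Φ patXY
    transitive φ ψ = xz-zy⇒Φ (Φ⇒xz φ) (Φ⇒zy ψ)

  TiedOn : (I → Set) → Pattern I → Set
  TiedOn N π = ∀ i → N i → Tie π i

  StrictOn : (I → Set) → Pattern I → Set
  StrictOn L π = ∀ i → L i → pro π i × ¬ con π i

  DecisiveΦ : (N L : I → Set) → Set₁
  DecisiveΦ N L = ∀ π → TiedOn N π → StrictOn L π → Φ π

  decisive⇒Φ : ∀ {N L} → Decisive C N L → DecisiveΦ N L
  decisive⇒Φ (_ , decisive) π tied strict =
    decisive (pairProfile x≢y π) x y
      (λ i Ni → Tie-resp (≈-sym P-π) i (tied i Ni))
      (λ i Li → from (proj₁ (P-π i)) (proj₁ (strict i Li)) , proj₂ (strict i Li) ∘ to (proj₂ (P-π i)))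
    where P-π = pairProfile-pattern x≢y π

  Φ⇒decisive : ∀ {N L} → (∀ i → L i → ¬ N i) → DecisiveΦ N L → Decisive C N L
  Φ⇒decisive disjoint decisive = disjoint , λ P a b tied strict → with-distinct P a b tied strict
    where
    with-distinct : ∀ P a b → _ → _ → rel (C P) a b
    with-distinct P a b tied strict with dec (a ≡ b)
    ... | yes refl = PPO.refl (C P) a
    ... | no a≢b = from (C⇔Φ P a≢b) (decisive (patternOf P a b) tied strict)

  contest : (N L : I → Set) → Pattern I
  contest N L i = (N i ⊎ L i) , (N i ⊎ ¬ L i)

  contest-tied : ∀ N L → TiedOn N (contest N L)
  contest-tied N L i Ni = inj₁ Ni , inj₁ Ni

  contest-strict : ∀ {N L} → (∀ i → L i → ¬ N i) → StrictOn L (contest N L)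
  contest-strict disjoint i Li = inj₂ Li , λ { (inj₁ Ni) → disjoint i Li Ni ; (inj₂ ¬Li) → ¬Li Li }

  -- Arrow's contagion lemma: z replays the contest against x and lies unanimously above y.
  contest⇒decisive : ∀ {N L} → Φ (contest N L) → DecisiveΦ N L
  contest⇒decisive {N} {L} φ σ tied strict =
    xz-zy⇒Φ (Φ⇒xz φ) (unanimous Q z y (λ i → from (threePoint-cb x≢y y≢z x≢z (T i)) tt))
    where
    T : I → ThreePointSpec
    T i = record
      { ab = pro σ i ; ba = con σ i ; ac = N i ⊎ L i ; ca = N i ⊎ ¬ L i ; cb = ⊤ ; bc = N i
      ; abc = λ _ Ni → inj₁ Ni
      ; acb = λ { (inj₁ Ni) _ → proj₁ (tied i Ni) ; (inj₂ Li) _ → proj₁ (strict i Li) }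
      ; bac = λ { _ (inj₁ Ni) → Ni ; c (inj₂ Li) → ⊥-elim (proj₂ (strict i Li) c) }
      ; bca = λ Ni _ → proj₂ (tied i Ni)
      ; cab = λ _ _ → tt
      ; cba = λ _ c → inj₂ (λ Li → proj₂ (strict i Li) c)
      }
    open Triangle T

  Φ-complete : ∀ π → (∀ i → pro π i ⊎ con π i) → Φ π ⊎ Φ (swap π)
  Φ-complete π complete =
    Sum.map (to (Φ-cong P-π) ∘ to (C⇔Φ P x≢y)) (to (Φ-cong (≈-swap P-π)) ∘ to (C⇔Φ P (x≢y ∘ sym)))
            (mapsLPO P (λ i → indicatorPreorder-complete (λ d → dec (Rank i d))) x y)
    where
    Rank : I → A → Set
    Rank i d = (d ≡ x × pro π i) ⊎ (d ≡ y × con π i)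
    P : I → PPO A
    P i = indicatorPreorder (Rank i)

    Rank-x : ∀ i → Rank i x ⇔ pro π i
    Rank-x i = mk⇔ (λ { (inj₁ (_ , p)) → p ; (inj₂ (x≡y , _)) → ⊥-elim (x≢y x≡y) })
                   (λ p → inj₁ (refl , p))

    Rank-y : ∀ i → Rank i y ⇔ con π i
    Rank-y i = mk⇔ (λ { (inj₁ (y≡x , _)) → ⊥-elim (x≢y (sym y≡x)) ; (inj₂ (_ , c)) → c })
                   (λ c → inj₂ (refl , c))

    P-π : patternOf P x y ≈ π
    P-π i = mk⇔ (λ r → [ (λ p → p) , (λ c → to (Rank-x i) (r (from (Rank-y i) c))) ]′ (complete i))
                (λ p _ → from (Rank-x i) p)
          , mk⇔ (λ r → [ (λ p → to (Rank-y i) (r (from (Rank-x i) p))) , (λ c → c) ]′ (complete i))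
                (λ c _ → from (Rank-y i) c)

  Core : (I → Set) → I → Set
  Core N = proj₁ (principal N)

  Core-decisive : ∀ N → Decisive C N (Core N)
  Core-decisive N = proj₁ (proj₂ (principal N))

  Core-minimal : ∀ N L → _⊆_ {A} L (Core N) → Decisive C N L → _⊆_ {A} (Core N) L
  Core-minimal N = proj₂ (proj₂ (principal N))

  Core-disjoint : ∀ {N i} → Core N i → ¬ N i
  Core-disjoint {N} {i} = proj₁ (Core-decisive N) i

  Core-empty⇒accepts : ∀ {N} → ¬ Σ I (Core N) → ∀ π → TiedOn N π → Φ π
  Core-empty⇒accepts {N} empty π tied =
    decisive⇒Φ (Core-decisive N) π tied (λ i Li → ⊥-elim (empty (i , Li)))

  Core-member⇒rejects : ∀ {N j} → Core N j → ¬ (∀ π → TiedOn N π → Φ π)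
  Core-member⇒rejects {N} {j} Lj accepts =
    Core-minimal N (λ _ → ⊥) (λ _ ()) (Φ⇒decisive (λ _ ()) (λ π tied _ → accepts π tied)) j Lj

  -- If {j} lost its contest, Core N ∖ {j} would win its own and so be decisive, against minimality.
  Core-member-decisive : ∀ {N j} → Core N j → DecisiveΦ N (_≡ j)
  Core-member-decisive {N} {j} Lj = contest⇒decisive (dne λ ¬φ → Core-minimal N M (λ _ → proj₁)
    (Φ⇒decisive (λ i → Core-disjoint ∘ proj₁) (contest⇒decisive (φM ¬φ))) j Lj .proj₂ refl)
    where
    M : I → Set
    M i = Core N i × i ≢ j

    T : I → ThreePointSpec
    T i = record
      { ab = N i ⊎ M i ; ba = N i ⊎ ¬ M i ; ac = N i ⊎ Core N i ; ca = N i ⊎ ¬ Core N i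
      ; cb = N i ⊎ i ≢ j ; bc = N i ⊎ i ≡ j
      ; abc = λ { (inj₁ Ni) _ → inj₁ Ni ; (inj₂ Mi) _ → inj₂ (proj₁ Mi) }
      ; acb = λ { (inj₁ Ni) _ → inj₁ Ni
                ; _ (inj₁ Ni) → inj₁ Ni
                ; (inj₂ Li) (inj₂ i≢j) → inj₂ (Li , i≢j) }
      ; bac = λ { (inj₁ Ni) _ → inj₁ Ni
                ; _ (inj₁ Ni) → inj₁ Ni
                ; (inj₂ ¬Mi) (inj₂ Li) → inj₂ (dne (λ i≢j → ¬Mi (Li , i≢j))) }
      ; bca = λ { (inj₁ Ni) _ → inj₁ Ni ; (inj₂ i≡j) _ → inj₂ (λ Mi → proj₂ Mi i≡j) }
      ; cab = λ { (inj₁ Ni) _ → inj₁ Ni ; _ (inj₁ Ni) → inj₁ Ni ; _ (inj₂ Mi) → inj₂ (proj₂ Mi) }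
      ; cba = λ { (inj₁ Ni) _ → inj₁ Ni
                ; _ (inj₁ Ni) → inj₁ Ni
                ; (inj₂ i≢j) (inj₂ ¬Mi) → inj₂ (λ Li → ¬Mi (Li , i≢j)) }
      }
    open Triangle T

    φM : ¬ Φ (contest N (_≡ j)) → Φ (contest N M)
    φM ¬φ = transitive
      (decisive⇒Φ (Core-decisive N) patXZ (contest-tied N (Core N))
                  (contest-strict (λ _ → Core-disjoint)))
      ([ (λ φ → ⊥-elim (¬φ φ)) , (λ ψ → ψ) ]′ (Φ-complete (contest N (_≡ j)) complete))
      where
      complete : ∀ i → pro (contest N (_≡ j)) i ⊎ con (contest N (_≡ j)) i
      complete i with dec (i ≡ j)
      ... | yes i≡j = inj₁ (inj₂ i≡j)
      ... | no i≢j = inj₂ (inj₂ i≢j)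

  Core-member-strict : ∀ {N j π} → Core N j → TiedOn N π → pro π j → ¬ con π j → Φ π
  Core-member-strict {π = π} Lj tied p ¬c = Core-member-decisive Lj π tied λ { _ refl → p , ¬c }

  private
    accepts-when-j-incomparable⇒accepts : ∀ {N j} → Core N j →
      (∀ σ → TiedOn N σ → ¬ con σ j → Φ σ) → ∀ σ → TiedOn N σ → Φ σ
    accepts-when-j-incomparable⇒accepts {N} {j} Lj accepts σ tied =
      transitive (accepts patXZ (λ i Ni → ≢j Ni , ≢j Ni) (λ f → f refl))
                 (accepts patZY (λ i Ni → (≢j Ni , proj₁ (tied i Ni)) , (≢j Ni , proj₂ (tied i Ni)))
                                (λ c → proj₁ c refl))
      where
      ≢j : ∀ {i} → N i → i ≢ j
      ≢j Ni refl = Core-disjoint Lj Ni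

      T : I → ThreePointSpec
      T i = record
        { ab = pro σ i ; ba = con σ i ; ac = i ≢ j ; ca = i ≢ j
        ; bc = i ≢ j × con σ i ; cb = i ≢ j × pro σ i
        ; abc = λ _ q → proj₁ q ; acb = λ _ q → proj₂ q ; bac = λ c i≢j → i≢j , c ; bca = λ q _ → proj₂ q
        ; cab = λ i≢j p → i≢j , p ; cba = λ q _ → proj₁ q
        }
      open Triangle T

    rejected-by-j-spreads : ∀ {N j π} → Core N j → TiedOn N π → ¬ pro π j → Φ π →
      ∀ σ → TiedOn N σ → (con σ j → con π j) → Φ σ
    rejected-by-j-spreads {N} {j} {π} Lj tiedπ ¬p φ σ tiedσ c⇒c =
      transitive φ (Core-member-strict Lj (λ i Ni → inj₁ Ni , inj₁ Ni) (inj₂ (inj₁ refl))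
                     λ { (inj₁ Nj) → Core-disjoint Lj Nj ; (inj₂ (_ , p)) → ¬p p })
      where
      T : I → ThreePointSpec
      T i = record
        { ab = pro σ i ; ba = con σ i ; ac = pro π i ; ca = con π i
        ; bc = N i ⊎ (con σ i × pro π i) ; cb = N i ⊎ (i ≡ j ⊎ (con π i × pro σ i))
        ; abc = λ { _ (inj₁ Ni) → proj₁ (tiedπ i Ni) ; _ (inj₂ (_ , p)) → p }
        ; acb = λ { _ (inj₁ Ni) → proj₁ (tiedσ i Ni)
                  ; p (inj₂ (inj₁ refl)) → ⊥-elim (¬p p)
                  ; _ (inj₂ (inj₂ (_ , p))) → p }
        ; bac = λ c p → inj₂ (c , p)
        ; bca = λ { (inj₁ Ni) _ → proj₂ (tiedσ i Ni) ; (inj₂ (c , _)) _ → c }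
        ; cab = λ c p → inj₂ (inj₂ (c , p))
        ; cba = λ { (inj₁ Ni) _ → proj₂ (tiedπ i Ni)
                  ; (inj₂ (inj₁ refl)) c → c⇒c c
                  ; (inj₂ (inj₂ (c , _))) _ → c }
        }
      open Triangle T

  Core-member-veto : ∀ {N j π} → Core N j → TiedOn N π → ¬ pro π j → ¬ Φ π
  Core-member-veto {N} {j} {π} Lj tied ¬p φ = Core-member⇒rejects Lj
    (accepts-when-j-incomparable⇒accepts Lj λ σ tiedσ ¬c →
      rejected-by-j-spreads Lj tied ¬p φ σ tiedσ (⊥-elim ∘ ¬c))

  J : I → Set
  J j = ¬ Φ (solo j)

  _≼_ : I → I → Set
  i ≼ j = i ≡ j ⊎ Φ (duel i j)

  Core-exists : ∀ {N j} → ¬ N j → J j → Σ I (Core N)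
  Core-exists {N} {j} ¬Nj Jj = dne λ empty →
    Jj (Core-empty⇒accepts empty (solo j) λ k Nk → (λ { refl → ¬Nj Nk }) , tt)

  Core⊆J : ∀ {N m} → Core N m → J m
  Core⊆J Lm = Core-member-veto Lm (λ k Nk → (λ { refl → Core-disjoint Lm Nk }) , tt) (λ f → f refl)

  duel-tied : ∀ {N i j} → ¬ N i → ¬ N j → TiedOn N (duel i j)
  duel-tied ¬Ni ¬Nj k Nk = (λ { refl → ¬Nj Nk }) , (λ { refl → ¬Ni Nk })

  Core-wins : ∀ {N m i} → Core N m → ¬ N i → m ≢ i → Φ (duel m i)
  Core-wins Lm ¬Ni m≢i = Core-member-strict Lm (duel-tied (Core-disjoint Lm) ¬Ni) m≢i (λ f → f refl)

  Core-loses : ∀ {N m i} → Core N m → ¬ N i → ¬ Φ (duel i m)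
  Core-loses Lm ¬Ni = Core-member-veto Lm (duel-tied ¬Ni (Core-disjoint Lm)) (λ f → f refl)

  -- The comparisons among a few voters are settled by the core relative to everybody else.
  Outside : (I → Set) → I → Set
  Outside S k = ¬ S k

  Core-outside : ∀ {S m} → Core (Outside S) m → S m
  Core-outside = dne ∘ Core-disjoint

  ≼-total : ∀ i j → J i → J j → i ≼ j ⊎ j ≼ i
  ≼-total i j Ji _ with dec (i ≡ j)
  ... | yes i≡j = inj₁ (inj₁ i≡j)
  ... | no i≢j with Core-exists {Outside λ k → k ≡ i ⊎ k ≡ j} (contradiction (inj₁ refl)) Ji
  ... | m , Lm with Core-outside Lm
  ...   | inj₁ refl = inj₁ (inj₂ (Core-wins Lm (contradiction (inj₂ refl)) i≢j))
  ...   | inj₂ refl = inj₂ (inj₂ (Core-wins Lm (contradiction (inj₁ refl)) (i≢j ∘ sym)))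

  ≼-antisym : ∀ i j → J i → J j → i ≼ j → j ≼ i → i ≡ j
  ≼-antisym i j _ _ (inj₁ i≡j) _ = i≡j
  ≼-antisym i j _ _ (inj₂ _) (inj₁ j≡i) = sym j≡i
  ≼-antisym i j Ji _ (inj₂ φ) (inj₂ ψ)
    with Core-exists {Outside λ k → k ≡ i ⊎ k ≡ j} (contradiction (inj₁ refl)) Ji
  ... | m , Lm with Core-outside Lm
  ...   | inj₁ refl = ⊥-elim (Core-loses Lm (contradiction (inj₂ refl)) ψ)
  ...   | inj₂ refl = ⊥-elim (Core-loses Lm (contradiction (inj₁ refl)) φ)

  ≼-trans : ∀ i j k → J i → J j → J k → i ≼ j → j ≼ k → i ≼ k
  ≼-trans i j k _ _ _ (inj₁ refl) j≼k = j≼k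
  ≼-trans i j k _ _ _ (inj₂ φ) (inj₁ refl) = inj₂ φ
  ≼-trans i j k Ji _ _ (inj₂ φ) (inj₂ ψ) with dec (i ≡ k)
  ... | yes i≡k = inj₁ i≡k
  ... | no i≢k with Core-exists {Outside λ t → t ≡ i ⊎ t ≡ j ⊎ t ≡ k} (contradiction (inj₁ refl)) Ji
  ... | m , Lm with Core-outside Lm
  ...   | inj₁ refl = inj₂ (Core-wins Lm (contradiction (inj₂ (inj₂ refl))) i≢k)
  ...   | inj₂ (inj₁ refl) = ⊥-elim (Core-loses Lm (contradiction (inj₁ refl)) φ)
  ...   | inj₂ (inj₂ refl) = ⊥-elim (Core-loses Lm (contradiction (inj₂ (inj₁ refl))) ψ)

  ≼-least : ∀ S → (∀ i → S i → J i) → Σ I S → Σ I (λ m → S m × (∀ i → S i → m ≼ i))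
  ≼-least S S⊆J (s , Ss) with Core-exists {Outside S} (contradiction Ss) (S⊆J s Ss)
  ... | m , Lm = m , Core-outside Lm , least
    where
    least : ∀ i → S i → m ≼ i
    least i Si with dec (m ≡ i)
    ... | yes m≡i = inj₁ m≡i
    ... | no m≢i = inj₂ (Core-wins Lm (contradiction Si) m≢i)

  ≼-isWellOrder : IsWellOrderOn J _≼_
  ≼-isWellOrder = record
    { reflexive = λ _ _ → inj₁ refl
    ; antisym = ≼-antisym
    ; transitive = ≼-trans
    ; total = ≼-total
    ; least = ≼-least
    }

  -- The core relative to the voters tied in π is the first untied voter of J, if there is one.
  Φ⇔lex : ∀ π → Φ π ⇔ LexPat J _≼_ π
  Φ⇔lex π with dec (Σ I (Core (Tie π)))
  ... | no empty = mk⇔ (λ _ → inj₁ all-tied) (λ _ → Core-empty⇒accepts empty π (λ _ t → t))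
    where
    all-tied : ∀ j → J j → Tie π j
    all-tied j Jj = dne λ ¬tie → empty (Core-exists ¬tie Jj)
  ... | yes (m , Lm) = mk⇔ lex lex⁻¹
    where
    Jm : J m
    Jm = Core⊆J Lm

    ¬tie : ¬ Tie π m
    ¬tie = Core-disjoint Lm

    before : ∀ k → J k → k ≼ m → k ≢ m → Tie π k
    before k _ (inj₁ k≡m) k≢m = ⊥-elim (k≢m k≡m)
    before k _ (inj₂ φ) _ = dne λ ¬tieₖ → Core-loses Lm ¬tieₖ φ

    decided-at-core : ∀ {j} → DecidedAt J _≼_ π j → j ≡ m
    decided-at-core {j} (Jj , ¬tieⱼ , beforeⱼ , _) = dne λ j≢m → case-on (≼-total j m Jj Jm) j≢m
      where
      case-on : j ≼ m ⊎ m ≼ j → ¬ j ≢ m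
      case-on (inj₁ (inj₁ j≡m)) j≢m = j≢m j≡m
      case-on (inj₁ (inj₂ φ)) _ = Core-loses Lm ¬tieⱼ φ
      case-on (inj₂ m≼j) j≢m = ¬tie (beforeⱼ m Jm m≼j (j≢m ∘ sym))

    lex : Φ π → LexPat J _≼_ π
    lex φ = inj₂ (m , Jm , ¬tie , before , dne λ ¬p → Core-member-veto Lm (λ _ t → t) ¬p φ)

    lex⁻¹ : LexPat J _≼_ π → Φ π
    lex⁻¹ (inj₁ all-tied) = ⊥-elim (¬tie (all-tied m Jm))
    lex⁻¹ (inj₂ (j , decided@(_ , _ , _ , pⱼ))) =
      Core-member-strict Lm (λ _ t → t) p (λ c → ¬tie (p , c))
      where
      p : pro π m
      p = subst (pro π) (decided-at-core decided) pⱼ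

  represents : Represents C (J , _≼_ , ≼-isWellOrder)
  represents P a b with dec (a ≡ b)
  ... | yes refl = mk⇔ (λ _ → inj₁ λ j _ → PPO.refl (P j) a , PPO.refl (P j) a) (λ _ → PPO.refl (C P) a)
  ... | no a≢b = Φ⇔lex (patternOf P a b) ⇔-∘ C⇔Φ P a≢b

theorem5p8 : ExcludedMiddle (lsuc 0ℓ) →
    (A I : Set) → AtLeastThree A →
    ((C : VotingSystem A I) → Admissible C →
      Σ (WOPair I) (λ W → Represents C W) ×
      (∀ (W W′ : WOPair I) → Represents C W → Represents C W′ → SameWO W W′) ×
      (∀ (W : WOPair I) → Represents C W →
        (StronglyUnanimous C ⇔ (∀ (i : I) → WOSet W i)))) ×
    ((W : WOPair I) → Σ (VotingSystem A I) (λ C → Admissible C × Represents C W))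
theorem5p8 em A I (x , y , z , x≢y , y≢z , x≢z) = analysis , realization
  where
  analysis : (C : VotingSystem A I) → Admissible C →
    Σ (WOPair I) (Represents C) ×
    (∀ W W′ → Represents C W → Represents C W′ → SameWO W W′) ×
    (∀ W → Represents C W → StronglyUnanimous C ⇔ (∀ i → WOSet W i))
  analysis C (principal , unanimous , iia , mapsLPO) =
    ((J , _≼_ , ≼-isWellOrder) , represents) ,
    represents-unique em x≢y C ,
    λ { (_ , _ , wo) rep → Lex.stronglyUnanimous⇔J-total em wo x≢y C rep }
    where open Forward em x≢y y≢z x≢z C principal unanimous iia mapsLPO

  realization : (W : WOPair I) → Σ (VotingSystem A I) (λ C → Admissible C × Represents C W)
  realization (_ , _ , wo) = lexSystem , lex-admissible x≢y , λ P a b → ⇔-id _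
    where open Lex em wo
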